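{- Let $k\geq 6$ and $c\geq 1$ be integers, and let $L_1,L_2$ be vertex-disjoint linear forests, each with exactly $c$ components, such that $|V(L_1)|+|V(L_2)|=2k$. Then there exists a set $E'$ of edges between $V(L_1)$ and $V(L_2)$ such that the graph $(V(L_1)\cup V(L_2), E'\cup E(L_1)\cup E(L_2))$ is isomorphic to the cycle $C_{2k}$.
   Context: A linear forest is a forest all of whose components are paths or isolated vertices. -}

module Defs where

open import Data.Nat using (ℕ; zero; suc; _+_; _*_; _≥_)
open import Data.Fin using (Fin; toℕ)
open import Data.Sum using (_⊎_; inj₁; inj₂)
open import Data.Product using (Σ; ∃; _×_; _,_)
open import Data.Empty using (⊥)
open import Relation.Nullary using (¬_)
open import Relation.Binary.PropositionalEquality using (_≡_)
open import Relation.Binary.Construct.Closure.ReflexiveTransitive using (Star)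
open import Function.Definitions using (Injective; Surjective)
open import Function.Bundles using (_⇔_; _↔_; Inverse)

record Graph (V : Set) : Set₁ where
  field
    Adj    : V → V → Set
    sym    : ∀ {u v} → Adj u v → Adj v u
    irrefl : ∀ {v} → ¬ Adj v v
open Graph public

Connected : {V : Set} → Graph V → V → V → Set
Connected G = Star (Adj G)

-- The set of vertices {v | comp v ≡ i} induces a path graph P_m (m ≥ 1,
-- P_1 = isolated vertex): there is an injective enumeration f of exactly
-- these vertices such that f j, f j' are adjacent iff j, j' are consecutive.
IsPathComponent : {V : Set} → Graph V → {c : ℕ} → (V → Fin c) → Fin c → Set
IsPathComponent {V} G comp i =
  Σ ℕ λ m → Σ (Fin m → V) λ f →
    Injective _≡_ _≡_ f
    × (∀ v → comp v ≡ i ⇔ (∃ λ j → f j ≡ v))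
    × (∀ j j' → Adj G (f j) (f j') ⇔ (toℕ j' ≡ suc (toℕ j) ⊎ toℕ j ≡ suc (toℕ j')))

-- G is a linear forest with exactly c components: the vertices are
-- labelled by their component (a surjection onto Fin c whose fibres are
-- exactly the connected components), and every component is a path.
LinearForestWithComponents : {V : Set} → Graph V → ℕ → Set
LinearForestWithComponents {V} G c =
  Σ (V → Fin c) λ comp →
    Surjective _≡_ _≡_ comp
    × (∀ u v → comp u ≡ comp v ⇔ Connected G u v)
    × (∀ i → IsPathComponent G comp i)

CycleAdj : (m : ℕ) → Fin m → Fin m → Set
CycleAdj m i j =
  (toℕ j ≡ suc (toℕ i) ⊎ toℕ i ≡ suc (toℕ j))
  ⊎ ((toℕ i ≡ 0 × suc (toℕ j) ≡ m) ⊎ (toℕ j ≡ 0 × suc (toℕ i) ≡ m))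

IsoToCycle : {V : Set} → (V → V → Set) → ℕ → Set
IsoToCycle {V} A m =
  Σ (V ↔ Fin m) λ φ →
    ∀ u v → A u v ⇔ CycleAdj m (Inverse.to φ u) (Inverse.to φ v)

-- Graph on V(L₁) ⊔ V(L₂) with edge set E' ∪ E(L₁) ∪ E(L₂), where E' is a set
-- of edges between V(L₁) and V(L₂) (given as a relation Fin n₁ → Fin n₂ → Set).
UnionAdj : {n₁ n₂ : ℕ} → Graph (Fin n₁) → Graph (Fin n₂) →
           (Fin n₁ → Fin n₂ → Set) → Fin n₁ ⊎ Fin n₂ → Fin n₁ ⊎ Fin n₂ → Set
UnionAdj L₁ L₂ E' (inj₁ a) (inj₁ b) = Adj L₁ a b
UnionAdj L₁ L₂ E' (inj₂ a) (inj₂ b) = Adj L₂ a b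
UnionAdj L₁ L₂ E' (inj₁ a) (inj₂ b) = E' a b
UnionAdj L₁ L₂ E' (inj₂ b) (inj₁ a) = E' a b

module Submission where

-- List the components of L₁ as paths P¹₀, …, P¹_{c-1} and those of
-- L₂ as P²₀, …, P²_{c-1}.  Because both forests have the same number c of
-- components, the walk  P¹₀ P²₀ P¹₁ P²₁ … P¹_{c-1} P²_{c-1}  visits every vertex
-- exactly once, and closing it up gives a Hamiltonian cycle of length
-- n₁ + n₂ = 2k.  All cycle edges that are not path edges join the end of some
-- P¹ᵢ to the start of P²ᵢ, the end of P²ᵢ to the start of P¹ᵢ₊₁, or (the
-- closing edge) the end of P²_{c-1} to the start of P¹₀; so they run between
-- V(L₁) and V(L₂) and form E'.

open import Defs
open import Data.Nat using (ℕ; _+_; _*_; _≥_)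
open import Data.Fin using (Fin)
open import Data.Product using (Σ)
open import Relation.Binary.PropositionalEquality using (_≡_)

open import Data.Nat using (zero; suc; _≤_; _<_; z≤n; s≤s)
open import Data.Nat.Properties
open import Data.Fin using (zero; suc; toℕ; splitAt; _↑ˡ_; _↑ʳ_)
open import Data.Fin.Properties
  using (toℕ-↑ˡ; toℕ-↑ʳ; splitAt-↑ˡ; splitAt-↑ʳ; splitAt⁻¹-↑ˡ; splitAt⁻¹-↑ʳ; toℕ-injective; toℕ<n; +↔⊎)
open import Data.Fin.Permutation using (↔⇒≡)
open import Data.Product using (_×_; _,_; proj₁; proj₂; ∃; map; map₂)
open import Data.Sum using (_⊎_; inj₁; inj₂; [_,_]′)
open import Data.Empty using (⊥; ⊥-elim)
open import Relation.Binary.PropositionalEquality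
  using (refl; trans; cong; subst; subst₂; module ≡-Reasoning)
  renaming (sym to ≡-sym)
open import Relation.Binary.Construct.Closure.ReflexiveTransitive using (_◅_; ε)
open import Relation.Binary.Definitions using (tri<; tri≈; tri>)
open import Function using (_∘_)
open import Function.Definitions using (Surjective)
open import Function.Bundles using (_⇔_; _↔_; Inverse; Equivalence; mk⇔; mk↔ₛ′)
open import Function.Construct.Composition using (_↔-∘_; _⇔-∘_)
open import Function.Construct.Symmetry using (↔-sym; ⇔-sym)
open import Function.Properties.Inverse using (↔-refl)
open import Function.Related.TypeIsomorphisms using (Σ-distribˡ-⊎)
open import Data.Sum.Function.Propositional using (_⊎-↔_)
open import Data.Product.Function.Dependent.Propositional using (Σ-↔)

-- 1. Blocks laid end to end

-- Blocks of sizes s 0, …, s (c-1) placed consecutively occupy `total s`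
-- positions, block i starting at position `offset s i`.
total : ∀ {c} → (Fin c → ℕ) → ℕ
total {zero}  s = 0
total {suc c} s = s zero + total (s ∘ suc)

offset : ∀ {c} → (Fin c → ℕ) → Fin c → ℕ
offset s zero    = 0
offset s (suc i) = s zero + offset (s ∘ suc) i

concatIndex : ∀ {c} (s : Fin c → ℕ) → Σ (Fin c) (λ i → Fin (s i)) → Fin (total s)
concatIndex {suc c} s (zero  , j) = j ↑ˡ total (s ∘ suc)
concatIndex {suc c} s (suc i , j) = s zero ↑ʳ concatIndex (s ∘ suc) (i , j)

splitIndex : ∀ {c} (s : Fin c → ℕ) → Fin (total s) → Σ (Fin c) (λ i → Fin (s i))
splitIndex {suc c} s x = [ (λ j → zero , j) , shift ]′ (splitAt (s zero) x)
  where
  shift : Fin (total (s ∘ suc)) → Σ (Fin (suc c)) (λ i → Fin (s i))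
  shift y = suc (proj₁ (splitIndex (s ∘ suc) y)) , proj₂ (splitIndex (s ∘ suc) y)

concat : ∀ {c} (s : Fin c → ℕ) → Σ (Fin c) (λ i → Fin (s i)) ↔ Fin (total s)
concat s = mk↔ₛ′ (concatIndex s) (splitIndex s) (concat-split s) (split-concat s)
  where
  concat-split : ∀ {c} (s : Fin c → ℕ) x → concatIndex s (splitIndex s x) ≡ x
  concat-split {suc c} s x with splitAt (s zero) x in eq
  ... | inj₁ j = splitAt⁻¹-↑ˡ eq
  ... | inj₂ y = trans (cong (s zero ↑ʳ_) (concat-split (s ∘ suc) y)) (splitAt⁻¹-↑ʳ eq)

  split-concat : ∀ {c} (s : Fin c → ℕ) p → splitIndex s (concatIndex s p) ≡ p
  split-concat {suc c} s (zero , j)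
    rewrite splitAt-↑ˡ (s zero) j (total (s ∘ suc)) = refl
  split-concat {suc c} s (suc i , j)
    rewrite splitAt-↑ʳ (s zero) (total (s ∘ suc)) (concatIndex (s ∘ suc) (i , j))
          | split-concat (s ∘ suc) (i , j) = refl

toℕ-concat : ∀ {c} (s : Fin c → ℕ) i j →
  toℕ (concatIndex s (i , j)) ≡ offset s i + toℕ j
toℕ-concat {suc c} s zero    j = toℕ-↑ˡ j _
toℕ-concat {suc c} s (suc i) j = begin
  toℕ (s zero ↑ʳ concatIndex (s ∘ suc) (i , j)) ≡⟨ toℕ-↑ʳ (s zero) _ ⟩
  s zero + toℕ (concatIndex (s ∘ suc) (i , j))  ≡⟨ cong (s zero +_) (toℕ-concat (s ∘ suc) i j) ⟩
  s zero + (offset (s ∘ suc) i + toℕ j)          ≡⟨ ≡-sym (+-assoc (s zero) _ _) ⟩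
  s zero + offset (s ∘ suc) i + toℕ j           ∎
  where open ≡-Reasoning

block-end≤offset : ∀ {c} (s : Fin c → ℕ) (i i' : Fin c) →
  toℕ i < toℕ i' → offset s i + s i ≤ offset s i'
block-end≤offset {suc c} s zero    (suc i') _         = m≤m+n (s zero) _
block-end≤offset {suc c} s (suc i) (suc i') (s≤s i<i')
  rewrite +-assoc (s zero) (offset (s ∘ suc) i) (s (suc i)) =
  +-monoʳ-≤ (s zero) (block-end≤offset (s ∘ suc) i i' i<i')

block-end≤total : ∀ {c} (s : Fin c → ℕ) (i : Fin c) → offset s i + s i ≤ total s
block-end≤total {suc c} s zero    = m≤m+n (s zero) _
block-end≤total {suc c} s (suc i)
  rewrite +-assoc (s zero) (offset (s ∘ suc) i) (s (suc i)) =
  +-monoʳ-≤ (s zero) (block-end≤total (s ∘ suc) i)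

successor-position : ∀ {c} (s : Fin c → ℕ) (i i' : Fin c) (a b : ℕ) →
  a < s i → b < s i' → offset s i' + b ≡ suc (offset s i + a) →
  (i ≡ i' × b ≡ suc a) ⊎ (suc a ≡ s i × b ≡ 0)
successor-position s i i' a b a<s b<s next with <-cmp (toℕ i) (toℕ i')
... | tri≈ _ i≡i' _ with toℕ-injective i≡i'
...   | refl = inj₁ (refl , +-cancelˡ-≡ (offset s i) b (suc a)
                              (trans next (≡-sym (+-suc (offset s i) a))))
successor-position s i i' a b a<s b<s next | tri< i<i' _ _ =
  inj₂ (≤-antisym a<s (m+n≤o⇒m≤o (s i) si+b≤sa) , n≤0⇒n≡0 b≤0)
  where
  -- block i ends before block i' starts, so its length fits in the step.
  si+b≤sa : s i + b ≤ suc a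
  si+b≤sa = +-cancelˡ-≤ (offset s i) _ _ (begin
    offset s i + (s i + b) ≡⟨ ≡-sym (+-assoc (offset s i) (s i) b) ⟩
    offset s i + s i + b   ≤⟨ +-monoˡ-≤ b (block-end≤offset s i i' i<i') ⟩
    offset s i' + b        ≡⟨ next ⟩
    suc (offset s i + a)   ≡⟨ ≡-sym (+-suc (offset s i) a) ⟩
    offset s i + suc a     ∎)
    where open ≤-Reasoning
  b≤0 : b ≤ 0
  b≤0 = +-cancelˡ-≤ (s i) b 0 (begin
    s i + b ≤⟨ si+b≤sa ⟩
    suc a   ≤⟨ a<s ⟩
    s i     ≡⟨ ≡-sym (+-identityʳ (s i)) ⟩
    s i + 0 ∎)
    where open ≤-Reasoning
successor-position s i i' a b a<s b<s next | tri> _ _ i'<i =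
  ⊥-elim (<-irrefl refl (begin-strict
    offset s i' + b       <⟨ +-monoʳ-< (offset s i') b<s ⟩
    offset s i' + s i'    ≤⟨ block-end≤offset s i' i i'<i ⟩
    offset s i            ≤⟨ m≤m+n (offset s i) a ⟩
    offset s i + a        <⟨ n<1+n _ ⟩
    suc (offset s i + a)  ≡⟨ ≡-sym next ⟩
    offset s i' + b       ∎))
  where open ≤-Reasoning

-- 2. Adjacency in the cycle

Consecutive : ℕ → ℕ → Set
Consecutive x y = y ≡ suc x ⊎ x ≡ suc y

-- Adjacency in the cycle on positions 0, …, T-1; `CycleAdj` is this relation
-- read on the values of its arguments.
CycleAdjℕ : ℕ → ℕ → ℕ → Set
CycleAdjℕ T x y = Consecutive x y ⊎ ((x ≡ 0 × suc y ≡ T) ⊎ (y ≡ 0 × suc x ≡ T))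

cycleAdjℕ-sym : ∀ {T x y} → CycleAdjℕ T x y → CycleAdjℕ T y x
cycleAdjℕ-sym (inj₁ (inj₁ e)) = inj₁ (inj₂ e)
cycleAdjℕ-sym (inj₁ (inj₂ e)) = inj₁ (inj₁ e)
cycleAdjℕ-sym (inj₂ (inj₁ e)) = inj₂ (inj₂ e)
cycleAdjℕ-sym (inj₂ (inj₂ e)) = inj₂ (inj₁ e)

cycleAdjℕ-cong : ∀ {T x x' y y'} → x ≡ x' → y ≡ y' → CycleAdjℕ T x y ⇔ CycleAdjℕ T x' y'
cycleAdjℕ-cong refl refl = mk⇔ (λ adj → adj) (λ adj → adj)

-- Inside each block i, a segment of length ℓ i starting at place o i.  If all
-- segments stay clear of their block's last place, or all stay clear of the
-- first place, then no cycle edge can leave a segment: two segment positions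
-- are adjacent in the cycle iff they are consecutive places of one segment.
module Segments {c : ℕ} (s o ℓ : Fin c → ℕ) (fits : ∀ i → o i + ℓ i ≤ s i)
       (clear : (∀ i → o i + ℓ i < s i) ⊎ (∀ i → 1 ≤ o i)) where

  position : Fin c → ℕ → ℕ
  position i a = offset s i + (o i + a)

  in-block : ∀ {i a} → a < ℓ i → o i + a < s i
  in-block {i} a<ℓ = <-≤-trans (+-monoʳ-< (o i) a<ℓ) (fits i)

  no-crossing : ∀ {i i' a b} → a < ℓ i → suc (o i + a) ≡ s i → o i' + b ≡ 0 → ⊥
  no-crossing {i} {i'} {a} {b} a<ℓ last first = [ before-end , after-start ]′ clear
    where
    before-end : (∀ i → o i + ℓ i < s i) → ⊥
    before-end end-clear = <-irrefl last (≤-<-trans (+-monoʳ-< (o i) a<ℓ) (end-clear i))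
    after-start : (∀ i → 1 ≤ o i) → ⊥
    after-start start-clear = <-irrefl (≡-sym first) (≤-trans (start-clear i') (m≤m+n (o i') b))

  step : ∀ {i i' a b} → a < ℓ i → b < ℓ i' →
    position i' b ≡ suc (position i a) → i ≡ i' × b ≡ suc a
  step {i} {i'} {a} {b} a<ℓ b<ℓ next
    with successor-position s i i' (o i + a) (o i' + b) (in-block a<ℓ) (in-block b<ℓ) next
  ... | inj₁ (refl , e)     = refl , +-cancelˡ-≡ (o i) b (suc a) (trans e (≡-sym (+-suc (o i) a)))
  ... | inj₂ (last , first) = ⊥-elim (no-crossing a<ℓ last first)

  no-wrap : ∀ {i i' a b} → b < ℓ i' →
    position i a ≡ 0 → suc (position i' b) ≡ total s → ⊥
  no-wrap {i} {i'} {a} {b} b<ℓ first last = [ before-end , after-start ]′ clear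
    where
    before-end : (∀ i → o i + ℓ i < s i) → ⊥
    before-end end-clear = <-irrefl last (begin-strict
      suc (offset s i' + (o i' + b)) ≡⟨ ≡-sym (+-suc (offset s i') _) ⟩
      offset s i' + suc (o i' + b)   ≤⟨ +-monoʳ-≤ (offset s i') (+-monoʳ-< (o i') b<ℓ) ⟩
      offset s i' + (o i' + ℓ i')    <⟨ +-monoʳ-< (offset s i') (end-clear i') ⟩
      offset s i' + s i'             ≤⟨ block-end≤total s i' ⟩
      total s                        ∎)
      where open ≤-Reasoning
    after-start : (∀ i → 1 ≤ o i) → ⊥
    after-start start-clear =
      <-irrefl (≡-sym (m+n≡0⇒m≡0 (o i) (m+n≡0⇒n≡0 (offset s i) first))) (start-clear i)

  cycle⇔consecutive : ∀ {i i' a b} → a < ℓ i → b < ℓ i' →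
    CycleAdjℕ (total s) (position i a) (position i' b) ⇔ (i ≡ i' × Consecutive a b)
  cycle⇔consecutive {i} {i'} {a} {b} a<ℓ b<ℓ = mk⇔ to from
    where
    to : CycleAdjℕ (total s) (position i a) (position i' b) → i ≡ i' × Consecutive a b
    to (inj₁ (inj₁ next))           = map₂ inj₁ (step a<ℓ b<ℓ next)
    to (inj₁ (inj₂ prev))           = map ≡-sym inj₂ (step b<ℓ a<ℓ prev)
    to (inj₂ (inj₁ (first , last))) = ⊥-elim (no-wrap {i} {i'} {a} b<ℓ first last)
    to (inj₂ (inj₂ (first , last))) = ⊥-elim (no-wrap {i'} {i} {b} a<ℓ first last)

    shift : ∀ {x y} → y ≡ suc x → offset s i + (o i + y) ≡ suc (offset s i + (o i + x))
    shift {x} refl = trans (cong (offset s i +_) (+-suc (o i) x)) (+-suc (offset s i) _)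

    from : i ≡ i' × Consecutive a b → CycleAdjℕ (total s) (position i a) (position i' b)
    from (refl , inj₁ next) = inj₁ (inj₁ (shift next))
    from (refl , inj₂ prev) = inj₁ (inj₂ (shift prev))

-- 3. A linear forest as a family of numbered paths

module PathDecomposition {n c : ℕ} (G : Graph (Fin n)) (F : LinearForestWithComponents G c) where

  component : Fin n → Fin c
  component = proj₁ F

  private
    component-surjective : Surjective _≡_ _≡_ component
    component-surjective = proj₁ (proj₂ F)

    same-component⇔connected : ∀ u v → component u ≡ component v ⇔ Connected G u v
    same-component⇔connected = proj₁ (proj₂ (proj₂ F))

    pathOf : ∀ i → IsPathComponent G component i
    pathOf = proj₂ (proj₂ (proj₂ F))

  len : Fin c → ℕ
  len i = proj₁ (pathOf i)

  path : (i : Fin c) → Fin (len i) → Fin n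
  path i = proj₁ (proj₂ (pathOf i))

  private
    path-injective : ∀ i {j j'} → path i j ≡ path i j' → j ≡ j'
    path-injective i = proj₁ (proj₂ (proj₂ (pathOf i)))

    on-path : ∀ i v → component v ≡ i ⇔ ∃ λ j → path i j ≡ v
    on-path i = proj₁ (proj₂ (proj₂ (proj₂ (pathOf i))))

    path-adj : ∀ i j j' → Adj G (path i j) (path i j') ⇔ Consecutive (toℕ j) (toℕ j')
    path-adj i = proj₂ (proj₂ (proj₂ (proj₂ (pathOf i))))

  place : (v : Fin n) → Fin (len (component v))
  place v = proj₁ (Equivalence.to (on-path (component v) v) refl)

  path-place : ∀ v → path (component v) (place v) ≡ v
  path-place v = proj₂ (Equivalence.to (on-path (component v) v) refl)

  component-path : ∀ i j → component (path i j) ≡ i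
  component-path i j = Equivalence.from (on-path i (path i j)) (j , refl)

  nonempty : ∀ i → 1 ≤ len i
  nonempty i = ≤-<-trans z≤n (toℕ<n j)
    where
    v = proj₁ (component-surjective i)
    j = proj₁ (Equivalence.to (on-path i v) (proj₂ (component-surjective i) refl))

  decompose : Fin n ↔ Σ (Fin c) (λ i → Fin (len i))
  decompose = mk↔ₛ′ (λ v → component v , place v) (λ (i , j) → path i j)
                     place-path path-place
    where
    same-place : ∀ {i i'} → i' ≡ i → ∀ j' j → path i' j' ≡ path i j →
      _≡_ {A = Σ (Fin c) (λ i → Fin (len i))} (i' , j') (i , j)
    same-place {i} refl j' j e = cong (i ,_) (path-injective i e)

    place-path : ∀ ((i , j) : Σ (Fin c) (λ i → Fin (len i))) →
      (component (path i j) , place (path i j)) ≡ (i , j)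
    place-path (i , j) = same-place
      (trans (≡-sym (component-path _ (place (path i j))))
             (trans (cong component (path-place (path i j))) (component-path i j)))
      (place (path i j)) j (path-place (path i j))

  adj⇔consecutive : ∀ u v →
    Adj G u v ⇔ (component u ≡ component v × Consecutive (toℕ (place u)) (toℕ (place v)))
  adj⇔consecutive u v = mk⇔ to from
    where
    adj-places : Adj G u v → Adj G (path _ (place u)) (path _ (place v))
    adj-places = subst₂ (Adj G) (≡-sym (path-place u)) (≡-sym (path-place v))

    consecutive : ∀ {i i'} → i ≡ i' → ∀ j j' → Adj G (path i j) (path i' j') →
      Consecutive (toℕ j) (toℕ j')
    consecutive {i} refl j j' = Equivalence.to (path-adj i j j')

    to : Adj G u v → component u ≡ component v × Consecutive (toℕ (place u)) (toℕ (place v))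
    to uv = same , consecutive same (place u) (place v) (adj-places uv)
      where
      same : component u ≡ component v
      same = Equivalence.from (same-component⇔connected u v) (uv ◅ ε)

    from-path : ∀ {i i'} → i ≡ i' → ∀ j j' → Consecutive (toℕ j) (toℕ j') →
      Adj G (path i j) (path i' j')
    from-path {i} refl j j' = Equivalence.from (path-adj i j j')

    from : component u ≡ component v × Consecutive (toℕ (place u)) (toℕ (place v)) → Adj G u v
    from (same , c) = subst₂ (Adj G) (path-place u) (path-place v)
                        (from-path same (place u) (place v) c)

-- 4. Interleaving the paths of two linear forests

module Interleave {c n₁ n₂ : ℕ} (L₁ : Graph (Fin n₁)) (L₂ : Graph (Fin n₂))
  (F₁ : LinearForestWithComponents L₁ c) (F₂ : LinearForestWithComponents L₂ c) where

  module P₁ = PathDecomposition L₁ F₁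
  module P₂ = PathDecomposition L₂ F₂

  -- Block i of the cycle is the i-th path of L₁ followed by the i-th path of L₂.
  size : Fin c → ℕ
  size i = P₁.len i + P₂.len i

  T : ℕ
  T = total size

  -- Each P₁-path ends before its block does; each P₂-path starts after it.
  module S₁ = Segments size (λ _ → 0) P₁.len (λ i → m≤m+n (P₁.len i) _)
                (inj₁ λ i → m<m+n (P₁.len i) (P₂.nonempty i))
  module S₂ = Segments size P₁.len P₂.len (λ i → ≤-refl) (inj₂ P₁.nonempty)

  -- Vertex ↦ (component, place) ↦ place in the block ↦ position on the cycle.
  φ : (Fin n₁ ⊎ Fin n₂) ↔ Fin T
  φ = concat size
      ↔-∘ (Σ-↔ ↔-refl (↔-sym +↔⊎)
      ↔-∘ (↔-sym Σ-distribˡ-⊎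
      ↔-∘ (P₁.decompose ⊎-↔ P₂.decompose)))

  position₁ : ∀ a → toℕ (Inverse.to φ (inj₁ a)) ≡ S₁.position (P₁.component a) (toℕ (P₁.place a))
  position₁ a = trans (toℕ-concat size (P₁.component a) _)
                      (cong (offset size (P₁.component a) +_) (toℕ-↑ˡ (P₁.place a) _))

  position₂ : ∀ b → toℕ (Inverse.to φ (inj₂ b)) ≡ S₂.position (P₂.component b) (toℕ (P₂.place b))
  position₂ b = trans (toℕ-concat size (P₂.component b) _)
                      (cong (offset size (P₂.component b) +_) (toℕ-↑ʳ (P₁.len (P₂.component b)) (P₂.place b)))

  E' : Fin n₁ → Fin n₂ → Set
  E' a b = CycleAdj T (Inverse.to φ (inj₁ a)) (Inverse.to φ (inj₂ b))

  φ-preserves-adj : ∀ u v → UnionAdj L₁ L₂ E' u v ⇔ CycleAdj T (Inverse.to φ u) (Inverse.to φ v)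
  φ-preserves-adj (inj₁ a) (inj₁ b) =
    cycleAdjℕ-cong (≡-sym (position₁ a)) (≡-sym (position₁ b))
    ⇔-∘ (⇔-sym (S₁.cycle⇔consecutive (toℕ<n (P₁.place a)) (toℕ<n (P₁.place b)))
    ⇔-∘ P₁.adj⇔consecutive a b)
  φ-preserves-adj (inj₂ a) (inj₂ b) =
    cycleAdjℕ-cong (≡-sym (position₂ a)) (≡-sym (position₂ b))
    ⇔-∘ (⇔-sym (S₂.cycle⇔consecutive (toℕ<n (P₂.place a)) (toℕ<n (P₂.place b)))
    ⇔-∘ P₂.adj⇔consecutive a b)
  φ-preserves-adj (inj₁ a) (inj₂ b) = mk⇔ (λ e → e) (λ e → e)
  φ-preserves-adj (inj₂ b) (inj₁ a) = mk⇔ cycleAdjℕ-sym cycleAdjℕ-sym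

  n₁+n₂≡T : n₁ + n₂ ≡ T
  n₁+n₂≡T = ↔⇒≡ (φ ↔-∘ +↔⊎)

proposition7p1 : (k c n₁ n₂ : ℕ) → k ≥ 6 → c ≥ 1 →
    (L₁ : Graph (Fin n₁)) → (L₂ : Graph (Fin n₂)) →
    LinearForestWithComponents L₁ c → LinearForestWithComponents L₂ c →
    n₁ + n₂ ≡ 2 * k →
    Σ (Fin n₁ → Fin n₂ → Set) λ E' → IsoToCycle (UnionAdj L₁ L₂ E') (2 * k)
proposition7p1 k c n₁ n₂ _ _ L₁ L₂ F₁ F₂ n₁+n₂≡2k =
  E' , subst (IsoToCycle (UnionAdj L₁ L₂ E')) T≡2k (φ , φ-preserves-adj)
  where
  open Interleave L₁ L₂ F₁ F₂
  T≡2k : T ≡ 2 * k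
  T≡2k = trans (≡-sym n₁+n₂≡T) n₁+n₂≡2k
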